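{- Let $H$ be a connected $2$-regular oriented graph and let $D$ be a subdigraph of $H$. Let $P=x_1x_2\dots x_\ell$ be an anti-directed path in $D$ with $|V(P)|\ge 3$ such that $N^+_D(x_1)=\{x_2\}$ or $N^-_D(x_1)=\{x_2\}$, and let $T=(\pi^{x_\ell},\pi_{x_\ell},\pi)$ be any good $x_\ell$-triple of $D-(V(P)\setminus\{x_\ell\})$. Then for any $\pi^*\in\{\pi^{x_\ell},\pi_{x_\ell}\}$ there exist (1) a good $x_1$-triple $(\sigma^{x_1},\sigma_{x_1},\sigma)$ of $D$ such that $\pi^*\le\sigma^{x_1}$, and (2) a good $x_1$-triple $(\sigma^{x_1},\sigma_{x_1},\sigma)$ of $D$ such that $\pi^*\le\sigma_{x_1}$.
   Context: An oriented graph is a digraph without loops, multiple arcs or directed $2$-cycles; $2$-regular means every vertex has in- and out-degree exactly $2$. An anti-directed path in $D$ is a path $x_1x_2\dots x_\ell$ in the underlying undirected graph of $D$ such that the directions of consecutive arcs alternate: for $2\le i\le \ell-1$, $x_{i-1}x_i$ being an arc implies $x_{i+1}x_i$ is an arc, and $x_ix_{i-1}$ being an arc implies $x_ix_{i+1}$ is an arc. For an ordering $\sigma$ of the vertex set, an arc $uv$ is backward with respect to $\sigma$ if $v$ precedes $u$. A triple of orderings $(\sigma_1,\sigma_2,\sigma_3)$ of the vertex set is good if every arc is backward with respect to exactly one of them; for a vertex $v$, a good triple is a $v$-triple if $v$ is first in $\sigma_1$ and last in $\sigma_2$, and it is written $(\sigma^v,\sigma_v,\sigma)$. For orderings $\sigma',\sigma$,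 $\sigma'\le\sigma$ means $\sigma'$ is obtained from $\sigma$ by deleting vertices. -}

module Defs where

open import Level using (0ℓ)
open import Data.Nat using (ℕ)
open import Data.Fin using (Fin)
open import Data.List using (List; []; _∷_; _++_; _∷ʳ_)
open import Data.List.Membership.Propositional using (_∈_)
open import Data.List.Relation.Unary.All using (All)
open import Data.List.Relation.Unary.Unique.Propositional using (Unique)
open import Data.Product using (Σ; _×_; ∃; ∃-syntax)
open import Data.Sum using (_⊎_)
open import Data.Unit using (⊤)
open import Relation.Nullary using (¬_)
open import Relation.Binary.PropositionalEquality using (_≡_; _≢_)
open import Relation.Binary.Construct.Closure.ReflexiveTransitive using (Star)

-- Vertices are drawn from Fin n.  A digraph on Fin n is given by an arc relation
-- (so multiple arcs are impossible by construction).
ArcRel : ℕ → Set₁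
ArcRel n = Fin n → Fin n → Set

Oriented : ∀ {n} → ArcRel n → Set
Oriented {n} A = (∀ v → ¬ A v v) × (∀ u v → A u v → ¬ A v u)

HasExactlyTwo : ∀ {n} → (Fin n → Set) → Set
HasExactlyTwo {n} R =
  Σ (Fin n) λ a → Σ (Fin n) λ b → a ≢ b × R a × R b × (∀ w → R w → w ≡ a ⊎ w ≡ b)

TwoRegular : ∀ {n} → ArcRel n → Set
TwoRegular {n} A = ∀ v → HasExactlyTwo (λ w → A v w) × HasExactlyTwo (λ w → A w v)

UAdj : ∀ {n} → ArcRel n → Fin n → Fin n → Set
UAdj A u v = A u v ⊎ A v u

Connected : ∀ {n} → ArcRel n → Set
Connected {n} A = ∀ (u v : Fin n) → Star (UAdj A) u v

record Subdigraph {n : ℕ} (AH : ArcRel n) : Set₁ where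
  field
    V     : Fin n → Set
    A     : ArcRel n
    A⊆AH  : ∀ u v → A u v → AH u v
    A-src : ∀ u v → A u v → V u
    A-tgt : ∀ u v → A u v → V v
open Subdigraph public

deleteVs : ∀ {n} {AH : ArcRel n} → Subdigraph AH → List (Fin n) → Subdigraph AH
deleteVs {n} {AH} D S = record
  { V     = V'
  ; A     = λ u v → A D u v × V' u × V' v
  ; A⊆AH  = λ u v p → A⊆AH D u v (Data.Product.proj₁ p)
  ; A-src = λ u v p → Data.Product.proj₁ (Data.Product.proj₂ p)
  ; A-tgt = λ u v p → Data.Product.proj₂ (Data.Product.proj₂ p)
  }
  where
  V' : Fin n → Set
  V' v = V D v × ¬ (v ∈ S)

OutNbrIsSingleton : ∀ {n} {AH : ArcRel n} → Subdigraph AH → Fin n → Fin n → Set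
OutNbrIsSingleton {n} D v w = ∀ (u : Fin n) → (A D v u → u ≡ w) × (u ≡ w → A D v u)

InNbrIsSingleton : ∀ {n} {AH : ArcRel n} → Subdigraph AH → Fin n → Fin n → Set
InNbrIsSingleton {n} D v w = ∀ (u : Fin n) → (A D u v → u ≡ w) × (u ≡ w → A D u v)

Linked : ∀ {n} → ArcRel n → List (Fin n) → Set
Linked A (a ∷ b ∷ rest) = UAdj A a b × Linked A (b ∷ rest)
Linked A _ = ⊤

Alternating : ∀ {n} → ArcRel n → List (Fin n) → Set
Alternating A (a ∷ b ∷ c ∷ rest) =
  ((A a b → A c b) × (A b a → A b c)) × Alternating A (b ∷ c ∷ rest)
Alternating A _ = ⊤

AntiDirectedPath : ∀ {n} {AH : ArcRel n} → Subdigraph AH → List (Fin n) → Set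
AntiDirectedPath D P = All (V D) P × Unique P × Linked (A D) P × Alternating (A D) P

IsOrdering : ∀ {n} {AH : ArcRel n} → Subdigraph AH → List (Fin n) → Set
IsOrdering {n} D σ = Unique σ × (∀ (v : Fin n) → (v ∈ σ → V D v) × (V D v → v ∈ σ))

Precedes : ∀ {n} → List (Fin n) → Fin n → Fin n → Set
Precedes {n} σ v u = Σ (List (Fin n)) λ xs → Σ (List (Fin n)) λ ys → σ ≡ xs ++ (v ∷ ys) × u ∈ ys

Backward : ∀ {n} → List (Fin n) → Fin n → Fin n → Set
Backward σ u v = Precedes σ v u

ExactlyOne : Set → Set → Set → Set
ExactlyOne P Q R = (P × ¬ Q × ¬ R) ⊎ (¬ P × Q × ¬ R) ⊎ (¬ P × ¬ Q × R)

GoodTriple : ∀ {n} {AH : ArcRel n} → Subdigraph AH → List (Fin n) → List (Fin n) → List (Fin n) → Set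
GoodTriple D σ₁ σ₂ σ₃ =
  IsOrdering D σ₁ × IsOrdering D σ₂ × IsOrdering D σ₃ ×
  (∀ u v → A D u v → ExactlyOne (Backward σ₁ u v) (Backward σ₂ u v) (Backward σ₃ u v))

VTriple : ∀ {n} {AH : ArcRel n} → Subdigraph AH → Fin n → List (Fin n) → List (Fin n) → List (Fin n) → Set
VTriple {n} D v σ₁ σ₂ σ₃ =
  GoodTriple D σ₁ σ₂ σ₃ ×
  (Σ (List (Fin n)) λ r → σ₁ ≡ v ∷ r) ×
  (Σ (List (Fin n)) λ r → σ₂ ≡ r ∷ʳ v)

module Submission where

-- Induction along P from x_ℓ back to x₁.  Suppose u has the single out-neighbour v
-- in G (dually, the single in-neighbour v).  A good triple of G − u in which v is
-- last (dually, first) in one ordering τ becomes a u-triple of G: put u first in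
-- one of the two other orderings, last in the remaining one, and just before
-- (dually, just after) v in τ.  The two other orderings may be taken in either
-- order, so a suborder of either of them is a suborder of the first ordering of one
-- such u-triple and of the second ordering of another; a suborder of τ is a
-- suborder of the third ordering.  In a v-triple τ is the second (dually, the
-- first) ordering.  Hence if π* is a suborder of some ordering of a v-triple, then
-- it is a suborder of the first ordering of one u-triple and of the second ordering
-- of another, or at least of the third ordering of one; and either outcome at v
-- gives the first one at u.  At x_{i+1} in D − {x₁, …, x_i}, 2-regularity of H
-- and the alternation of P leave x_{i+2} as the only in- or out-neighbour.

open import Defs
open import Data.Nat using (ℕ)
open import Data.Fin using (Fin)
open import Data.Fin.Properties using (_≟_)
open import Data.List using (List; []; _∷_; _++_; _∷ʳ_)
open import Data.List.Properties using (++-assoc; ++-identityʳ)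
open import Data.List.Membership.Propositional using (_∈_; _∉_)
open import Data.List.Membership.Propositional.Properties using (∈-++⁺ˡ; ∈-++⁺ʳ; ∈-++⁻)
open import Data.List.Relation.Unary.Any using (here; there)
open import Data.List.Relation.Unary.All as All using (All; []; _∷_)
open import Data.List.Relation.Unary.All.Properties using (¬Any⇒All¬)
open import Data.List.Relation.Unary.AllPairs using (_∷_)
open import Data.List.Relation.Unary.Unique.Propositional using (Unique)
open import Data.List.Relation.Unary.Unique.Propositional.Properties using (Unique[x∷xs]⇒x∉xs)
open import Data.List.Relation.Binary.Permutation.Propositional using (_↭_; ↭-sym; ↭⇒↭ₛ)
open import Data.List.Relation.Binary.Permutation.Propositional.Properties using (shift; ∈-resp-↭)
import Data.List.Relation.Binary.Permutation.Setoid.Properties as ↭ₛ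
open import Data.List.Relation.Binary.Sublist.Propositional using (_⊆_; ⊆-refl; ⊆-trans)
open import Data.List.Relation.Binary.Sublist.Propositional.Properties using (++⁺; ++⁺ˡ; ++⁺ʳ)
open import Data.Product using (Σ; _×_; _,_; proj₁; proj₂)
open import Data.Sum using (_⊎_; inj₁; inj₂; [_,_]′)
open import Data.Unit using (tt)
open import Data.Empty using (⊥-elim)
open import Function using (_∘_; _⇔_; mk⇔; Equivalence)
open import Relation.Nullary using (¬_; yes; no)
open import Relation.Binary.PropositionalEquality using (_≡_; _≢_; refl; sym; subst; setoid)

open Equivalence using (to; from)

private
  variable
    n : ℕ
    AH : ArcRel n
    G : Subdigraph AH
    a p q u v w x y : Fin n
    B P S ρ α β σ σ₁ σ₂ σ₃ s t : List (Fin n)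
    X Y Z X′ Y′ Z′ : Set

ExactlyOne-resp-⇔ : X ⇔ X′ → Y ⇔ Y′ → Z ⇔ Z′ →
                    ExactlyOne X Y Z → ExactlyOne X′ Y′ Z′
ExactlyOne-resp-⇔ x y z (inj₁ (x₀ , ¬y , ¬z)) =
  inj₁ (to x x₀ , ¬y ∘ from y , ¬z ∘ from z)
ExactlyOne-resp-⇔ x y z (inj₂ (inj₁ (¬x , y₀ , ¬z))) =
  inj₂ (inj₁ (¬x ∘ from x , to y y₀ , ¬z ∘ from z))
ExactlyOne-resp-⇔ x y z (inj₂ (inj₂ (¬x , ¬y , z₀))) =
  inj₂ (inj₂ (¬x ∘ from x , ¬y ∘ from y , to z z₀))

ExactlyOne-swap₁₂ : ExactlyOne X Y Z → ExactlyOne Y X Z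
ExactlyOne-swap₁₂ (inj₁ (x , ¬y , ¬z)) = inj₂ (inj₁ (¬y , x , ¬z))
ExactlyOne-swap₁₂ (inj₂ (inj₁ (¬x , y , ¬z))) = inj₁ (y , ¬x , ¬z)
ExactlyOne-swap₁₂ (inj₂ (inj₂ (¬x , ¬y , z))) = inj₂ (inj₂ (¬y , ¬x , z))

ExactlyOne-swap₂₃ : ExactlyOne X Y Z → ExactlyOne X Z Y
ExactlyOne-swap₂₃ (inj₁ (x , ¬y , ¬z)) = inj₁ (x , ¬z , ¬y)
ExactlyOne-swap₂₃ (inj₂ (inj₁ (¬x , y , ¬z))) = inj₂ (inj₂ (¬x , ¬z , y))
ExactlyOne-swap₂₃ (inj₂ (inj₂ (¬x , ¬y , z))) = inj₂ (inj₁ (¬x , z , ¬y))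

GoodTriple-swap₁₂ : GoodTriple G σ₁ σ₂ σ₃ → GoodTriple G σ₂ σ₁ σ₃
GoodTriple-swap₁₂ (o₁ , o₂ , o₃ , good) =
  o₂ , o₁ , o₃ , λ x y a → ExactlyOne-swap₁₂ (good x y a)

GoodTriple-swap₂₃ : GoodTriple G σ₁ σ₂ σ₃ → GoodTriple G σ₁ σ₃ σ₂
GoodTriple-swap₂₃ (o₁ , o₂ , o₃ , good) =
  o₁ , o₃ , o₂ , λ x y a → ExactlyOne-swap₂₃ (good x y a)

Unique-resp-↭ : ∀ {n} {s t : List (Fin n)} → s ↭ t → Unique s → Unique t
Unique-resp-↭ {n} s↭t = ↭ₛ.Unique-resp-↭ (setoid (Fin n)) (↭⇒↭ₛ s↭t)

Unique-∷ : u ∉ s → Unique s → Unique (u ∷ s)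
Unique-∷ u∉s uniq = ¬Any⇒All¬ _ u∉s ∷ uniq

Unique-insert⁻ : ∀ t → Unique (t ++ u ∷ s) → u ∉ t ++ s
Unique-insert⁻ {u = u} {s = s} t = Unique[x∷xs]⇒x∉xs ∘ Unique-resp-↭ (shift u t s)

∈-insert⁺ : ∀ t → w ∈ t ++ s → w ∈ t ++ u ∷ s
∈-insert⁺ {s = s} {u = u} t w∈ = ∈-resp-↭ (↭-sym (shift u t s)) (there w∈)

∈-insert⁻ : ∀ t → w ≢ u → w ∈ t ++ u ∷ s → w ∈ t ++ s
∈-insert⁻ {u = u} {s = s} t w≢u w∈ with ∈-resp-↭ (shift u t s) w∈
... | here w≡u = ⊥-elim (w≢u w≡u)
... | there w∈′ = w∈′

∉-∷ʳ : w ∉ B → w ≢ u → w ∉ B ∷ʳ u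
∉-∷ʳ {B = B} w∉B w≢u w∈ with ∈-++⁻ B w∈
... | inj₁ w∈B = w∉B w∈B
... | inj₂ (here w≡u) = w≢u w≡u

⊆-insert : ∀ t → ρ ⊆ t ++ s → ρ ⊆ t ++ u ∷ s
⊆-insert {u = u} t ρ⊆ = ⊆-trans ρ⊆ (++⁺ (⊆-refl {x = t}) (++⁺ˡ (u ∷ []) ⊆-refl))

Precedes-here : x ∈ σ → Precedes (y ∷ σ) y x
Precedes-here {σ = σ} x∈σ = [] , σ , refl , x∈σ

Precedes-there : Precedes σ y x → Precedes (a ∷ σ) y x
Precedes-there (xs , ys , refl , x∈ys) = _ ∷ xs , ys , refl , x∈ys

Precedes-∷⁻ : Precedes (a ∷ σ) y x → (y ≡ a × x ∈ σ) ⊎ Precedes σ y x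
Precedes-∷⁻ ([] , ys , refl , x∈ys) = inj₁ (refl , x∈ys)
Precedes-∷⁻ (_ ∷ xs , ys , refl , x∈ys) = inj₂ (xs , ys , refl , x∈ys)

Precedes⇒∈ˡ : Precedes σ y x → y ∈ σ
Precedes⇒∈ˡ (xs , _ , refl , _) = ∈-++⁺ʳ xs (here refl)

Precedes⇒∈ʳ : Precedes σ y x → x ∈ σ
Precedes⇒∈ʳ (xs , _ , refl , x∈ys) = ∈-++⁺ʳ xs (there x∈ys)

Precedes-++ : y ∈ t → x ∈ s → Precedes (t ++ s) y x
Precedes-++ {t = _ ∷ t} (here refl) x∈s = Precedes-here (∈-++⁺ʳ t x∈s)
Precedes-++ (there y∈t) x∈s = Precedes-there (Precedes-++ y∈t x∈s)

Precedes-++ʳ : ∀ t → Precedes σ y x → Precedes (t ++ σ) y x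
Precedes-++ʳ [] p = p
Precedes-++ʳ (_ ∷ t) p = Precedes-there (Precedes-++ʳ t p)

Precedes-insert⁺ : ∀ t → Precedes (t ++ s) y x → Precedes (t ++ u ∷ s) y x
Precedes-insert⁺ [] p = Precedes-there p
Precedes-insert⁺ (_ ∷ t) p with Precedes-∷⁻ p
... | inj₁ (refl , x∈) = Precedes-here (∈-insert⁺ t x∈)
... | inj₂ p′ = Precedes-there (Precedes-insert⁺ t p′)

Precedes-insert⁻ : ∀ t → y ≢ u → x ≢ u → Precedes (t ++ u ∷ s) y x → Precedes (t ++ s) y x
Precedes-insert⁻ [] y≢u x≢u p with Precedes-∷⁻ p
... | inj₁ (y≡u , _) = ⊥-elim (y≢u y≡u)
... | inj₂ p′ = p′
Precedes-insert⁻ (_ ∷ t) y≢u x≢u p with Precedes-∷⁻ p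
... | inj₁ (refl , x∈) = Precedes-here (∈-insert⁻ t x≢u x∈)
... | inj₂ p′ = Precedes-there (Precedes-insert⁻ t y≢u x≢u p′)

Precedes-insert : ∀ t → y ≢ u → x ≢ u → Precedes (t ++ s) y x ⇔ Precedes (t ++ u ∷ s) y x
Precedes-insert t y≢u x≢u = mk⇔ (Precedes-insert⁺ t) (Precedes-insert⁻ t y≢u x≢u)

∈prefix⇔Precedes-inserted : ∀ t → u ∉ s → y ∈ t ⇔ Precedes (t ++ u ∷ s) y u
∈prefix⇔Precedes-inserted {u = u} {s = s} {y = y} t u∉s =
  mk⇔ (λ y∈t → Precedes-++ y∈t (here refl)) (prefix t)
  where
  prefix : ∀ t → Precedes (t ++ u ∷ s) y u → y ∈ t
  prefix [] p with Precedes-∷⁻ p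
  ... | inj₁ (_ , u∈s) = ⊥-elim (u∉s u∈s)
  ... | inj₂ p′ = ⊥-elim (u∉s (Precedes⇒∈ʳ p′))
  prefix (_ ∷ t) p with Precedes-∷⁻ p
  ... | inj₁ (refl , _) = here refl
  ... | inj₂ p′ = there (prefix t p′)

∈suffix⇔inserted-Precedes : ∀ t → u ∉ t → u ∉ s → x ∈ s ⇔ Precedes (t ++ u ∷ s) u x
∈suffix⇔inserted-Precedes {u = u} {s = s} {x = x} t u∉t u∉s =
  mk⇔ (Precedes-++ʳ t ∘ Precedes-here) (suffix t u∉t)
  where
  suffix : ∀ t → u ∉ t → Precedes (t ++ u ∷ s) u x → x ∈ s
  suffix [] _ p with Precedes-∷⁻ p
  ... | inj₁ (_ , x∈s) = x∈s
  ... | inj₂ p′ = ⊥-elim (u∉s (Precedes⇒∈ˡ p′))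
  suffix (_ ∷ t) u∉t p with Precedes-∷⁻ p
  ... | inj₁ (u≡ , _) = ⊥-elim (u∉t (here u≡))
  ... | inj₂ p′ = suffix t (u∉t ∘ there) p′

record IsVertexDeletion {n} {AH : ArcRel n} (G : Subdigraph AH) (u : Fin n)
                        (G′ : Subdigraph AH) : Set where
  field
    V-deleted   : V G u
    V-remaining : ∀ w → V G′ w ⇔ (V G w × w ≢ u)
    A-remaining : ∀ {x y} → A G x y → x ≢ u → y ≢ u → A G′ x y

SingletonNbr : ∀ {n} {AH : ArcRel n} → Subdigraph AH → Fin n → Fin n → Set
SingletonNbr G u v = OutNbrIsSingleton G u v ⊎ InNbrIsSingleton G u v

data Slot : Set where
  first second third : Slot

slot : Slot → X → X → X → X
slot first  σ₁ σ₂ σ₃ = σ₁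
slot second σ₁ σ₂ σ₃ = σ₂
slot third  σ₁ σ₂ σ₃ = σ₃

Extends : ∀ {n} {AH : ArcRel n} → Subdigraph AH → Fin n → List (Fin n) → Slot → Set
Extends {n} G v ρ i =
  Σ (List (Fin n)) λ σ₁ → Σ (List (Fin n)) λ σ₂ → Σ (List (Fin n)) λ σ₃ →
    VTriple G v σ₁ σ₂ σ₃ × ρ ⊆ slot i σ₁ σ₂ σ₃

ExtendsBoth : ∀ {n} {AH : ArcRel n} → Subdigraph AH → Fin n → List (Fin n) → Set
ExtendsBoth G v ρ = Extends G v ρ first × Extends G v ρ second

ExtendsBothOrThird : ∀ {n} {AH : ArcRel n} → Subdigraph AH → Fin n → List (Fin n) → Set
ExtendsBothOrThird G v ρ = ExtendsBoth G v ρ ⊎ Extends G v ρ third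

module Insertion {n} {AH : ArcRel n} (ori : Oriented AH) {G G′ : Subdigraph AH} {u : Fin n}
                 (del : IsVertexDeletion G u G′) where
  open IsVertexDeletion del

  no-loop : ¬ A G u u
  no-loop = proj₁ ori u ∘ A⊆AH G u u

  V-remaining⁺ : V G w → w ≢ u → V G′ w
  V-remaining⁺ {w = w} vw w≢u = from (V-remaining w) (vw , w≢u)

  u∉ordering : IsOrdering G′ σ → u ∉ σ
  u∉ordering (_ , mem) u∈σ = proj₂ (to (V-remaining u) (proj₁ (mem u) u∈σ)) refl

  IsOrdering-insert : ∀ t → IsOrdering G′ (t ++ s) → IsOrdering G (t ++ u ∷ s)
  IsOrdering-insert {s = s} t o@(uniq , mem) =
    Unique-resp-↭ (↭-sym (shift u t s)) (Unique-∷ (u∉ordering o) uniq) ,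
    λ w → inserted⇒V w , V⇒inserted w
    where
    inserted⇒V : ∀ w → w ∈ t ++ u ∷ s → V G w
    inserted⇒V w w∈ with ∈-resp-↭ (shift u t s) w∈
    ... | here refl = V-deleted
    ... | there w∈′ = proj₁ (to (V-remaining w) (proj₁ (mem w) w∈′))
    V⇒inserted : ∀ w → V G w → w ∈ t ++ u ∷ s
    V⇒inserted w vw with w ≟ u
    ... | yes refl = ∈-resp-↭ (↭-sym (shift u t s)) (here refl)
    ... | no w≢u = ∈-insert⁺ t (proj₂ (mem w) (V-remaining⁺ vw w≢u))

  GoodTriple-insert : ∀ t₁ s₁ t₂ s₂ t₃ s₃ →
    GoodTriple G′ (t₁ ++ s₁) (t₂ ++ s₂) (t₃ ++ s₃) →
    (∀ y → A G u y → ExactlyOne (y ∈ t₁) (y ∈ t₂) (y ∈ t₃)) →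
    (∀ x → A G x u → ExactlyOne (x ∈ s₁) (x ∈ s₂) (x ∈ s₃)) →
    GoodTriple G (t₁ ++ u ∷ s₁) (t₂ ++ u ∷ s₂) (t₃ ++ u ∷ s₃)
  GoodTriple-insert t₁ s₁ t₂ s₂ t₃ s₃ (o₁ , o₂ , o₃ , good) out-nbrs in-nbrs =
    IsOrdering-insert t₁ o₁ , IsOrdering-insert t₂ o₂ , IsOrdering-insert t₃ o₃ , arcs
    where
    prefix : ∀ t {s y} → IsOrdering G′ (t ++ s) → y ∈ t ⇔ Precedes (t ++ u ∷ s) y u
    prefix t o = ∈prefix⇔Precedes-inserted t (u∉ordering o ∘ ∈-++⁺ʳ t)
    suffix : ∀ t {s x} → IsOrdering G′ (t ++ s) → x ∈ s ⇔ Precedes (t ++ u ∷ s) u x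
    suffix t o =
      ∈suffix⇔inserted-Precedes t (u∉ordering o ∘ ∈-++⁺ˡ) (u∉ordering o ∘ ∈-++⁺ʳ t)
    arcs : ∀ x y → A G x y → ExactlyOne (Backward (t₁ ++ u ∷ s₁) x y)
                                        (Backward (t₂ ++ u ∷ s₂) x y) (Backward (t₃ ++ u ∷ s₃) x y)
    arcs x y a with x ≟ u | y ≟ u
    ... | yes refl | yes refl = ⊥-elim (no-loop a)
    ... | yes refl | no _ =
      ExactlyOne-resp-⇔ (prefix t₁ o₁) (prefix t₂ o₂) (prefix t₃ o₃) (out-nbrs y a)
    ... | no _ | yes refl =
      ExactlyOne-resp-⇔ (suffix t₁ o₁) (suffix t₂ o₂) (suffix t₃ o₃) (in-nbrs x a)
    ... | no x≢u | no y≢u =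
      ExactlyOne-resp-⇔ (Precedes-insert t₁ y≢u x≢u) (Precedes-insert t₂ y≢u x≢u)
                        (Precedes-insert t₃ y≢u x≢u) (good x y (A-remaining a x≢u y≢u))

  VTriple-insert : ∀ t s → GoodTriple G′ α β (t ++ s) →
    (∀ y → A G u y → y ∉ t) → (∀ x → A G x u → x ∉ s) →
    VTriple G u (u ∷ α) (β ∷ʳ u) (t ++ u ∷ s)
  VTriple-insert {α = α} {β = β} t s gt@(oα , oβ , _) out∉t in∉s =
    GoodTriple-insert [] α β [] t s gt′ out-nbrs in-nbrs , (α , refl) , (β , refl)
    where
    gt′ : GoodTriple G′ α (β ++ []) (t ++ s)
    gt′ = subst (λ σ → GoodTriple G′ α σ (t ++ s)) (sym (++-identityʳ β)) gt
    out-nbrs : ∀ y → A G u y → ExactlyOne (y ∈ []) (y ∈ β) (y ∈ t)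
    out-nbrs y a = inj₂ (inj₁ ((λ ()) , proj₂ (proj₂ oβ y) vy , out∉t y a))
      where vy = V-remaining⁺ (A-tgt G u y a) λ { refl → no-loop a }
    in-nbrs : ∀ x → A G x u → ExactlyOne (x ∈ α) (x ∈ []) (x ∈ s)
    in-nbrs x a = inj₁ (proj₂ (proj₂ oα x) vx , (λ ()) , in∉s x a)
      where vx = V-remaining⁺ (A-src G x u a) λ { refl → no-loop a }

  outTriple : OutNbrIsSingleton G u v → ∀ t → GoodTriple G′ α β (t ∷ʳ v) →
              VTriple G u (u ∷ α) (β ∷ʳ u) (t ++ u ∷ v ∷ [])
  outTriple {v = v} sing t gt@(_ , _ , (uniq , _) , _) = VTriple-insert t (v ∷ []) gt out∉t in∉v
    where
    out∉t : ∀ y → A G u y → y ∉ t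
    out∉t y a y∈t with proj₁ (sing y) a
    ... | refl = Unique-insert⁻ t uniq (∈-++⁺ˡ y∈t)
    in∉v : ∀ x → A G x u → x ∉ v ∷ []
    in∉v x a (here refl) = proj₂ ori u v (A⊆AH G u v (proj₂ (sing v) refl)) (A⊆AH G v u a)

  inTriple : InNbrIsSingleton G u v → ∀ t → GoodTriple G′ α β (v ∷ t) →
             VTriple G u (u ∷ α) (β ∷ʳ u) (v ∷ u ∷ t)
  inTriple {v = v} sing t gt@(_ , _ , (uniq , _) , _) = VTriple-insert (v ∷ []) t gt out∉v in∉t
    where
    out∉v : ∀ y → A G u y → y ∉ v ∷ []
    out∉v y a (here refl) = proj₂ ori v u (A⊆AH G v u (proj₂ (sing v) refl)) (A⊆AH G u v a)
    in∉t : ∀ x → A G x u → x ∉ t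
    in∉t x a with proj₁ (sing x) a
    ... | refl = Unique[x∷xs]⇒x∉xs uniq

  swap₁₂ : GoodTriple G′ σ₁ σ₂ σ₃ → GoodTriple G′ σ₂ σ₁ σ₃
  swap₁₂ = GoodTriple-swap₁₂ {G = G′}

  swap₂₃ : GoodTriple G′ σ₁ σ₂ σ₃ → GoodTriple G′ σ₁ σ₃ σ₂
  swap₂₃ = GoodTriple-swap₂₃ {G = G′}

  ExtendsBoth-out : OutNbrIsSingleton G u v → ∀ t → GoodTriple G′ α β (t ∷ʳ v) → ρ ⊆ α →
                    ExtendsBoth G u ρ
  ExtendsBoth-out sing t gt ρ⊆α =
    (_ , _ , _ , outTriple sing t gt , ⊆-insert [] ρ⊆α) ,
    (_ , _ , _ , outTriple sing t (swap₁₂ gt) , ++⁺ʳ (u ∷ []) ρ⊆α)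

  ExtendsBoth-in : InNbrIsSingleton G u v → ∀ t → GoodTriple G′ α β (v ∷ t) → ρ ⊆ α →
                   ExtendsBoth G u ρ
  ExtendsBoth-in sing t gt ρ⊆α =
    (_ , _ , _ , inTriple sing t gt , ⊆-insert [] ρ⊆α) ,
    (_ , _ , _ , inTriple sing t (swap₁₂ gt) , ++⁺ʳ (u ∷ []) ρ⊆α)

  extend-out₁ : OutNbrIsSingleton G u v → Extends G′ v ρ first → ExtendsBoth G u ρ
  extend-out₁ sing (_ , _ , _ , (gt , _ , t , refl) , ρ⊆) =
    ExtendsBoth-out sing t (swap₂₃ gt) ρ⊆

  extend-out₂ : OutNbrIsSingleton G u v → Extends G′ v ρ second → Extends G u ρ third
  extend-out₂ sing (_ , _ , _ , (gt , _ , t , refl) , ρ⊆) =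
    _ , _ , _ , outTriple sing t (swap₂₃ gt) , ⊆-insert t ρ⊆

  extend-out₃ : OutNbrIsSingleton G u v → Extends G′ v ρ third → ExtendsBoth G u ρ
  extend-out₃ sing (_ , _ , _ , (gt , _ , t , refl) , ρ⊆) =
    ExtendsBoth-out sing t (swap₁₂ (swap₂₃ gt)) ρ⊆

  extend-in₁ : InNbrIsSingleton G u v → Extends G′ v ρ first → Extends G u ρ third
  extend-in₁ {v = v} sing (_ , _ , _ , (gt , (t , refl) , _) , ρ⊆) =
    _ , _ , _ , inTriple sing t (swap₂₃ (swap₁₂ gt)) ,
    ⊆-insert (v ∷ []) ρ⊆

  extend-in₂ : InNbrIsSingleton G u v → Extends G′ v ρ second → ExtendsBoth G u ρ
  extend-in₂ sing (_ , _ , _ , (gt , (t , refl) , _) , ρ⊆) =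
    ExtendsBoth-in sing t (swap₂₃ (swap₁₂ gt)) ρ⊆

  extend-in₃ : InNbrIsSingleton G u v → Extends G′ v ρ third → ExtendsBoth G u ρ
  extend-in₃ sing (_ , _ , _ , (gt , (t , refl) , _) , ρ⊆) =
    ExtendsBoth-in sing t (swap₁₂ (swap₂₃ (swap₁₂ gt))) ρ⊆

  extend : SingletonNbr G u v → ∀ i → Extends G′ v ρ i → ExtendsBothOrThird G u ρ
  extend (inj₁ sing) first  e = inj₁ (extend-out₁ sing e)
  extend (inj₁ sing) second e = inj₂ (extend-out₂ sing e)
  extend (inj₁ sing) third  e = inj₁ (extend-out₃ sing e)
  extend (inj₂ sing) first  e = inj₂ (extend-in₁ sing e)
  extend (inj₂ sing) second e = inj₁ (extend-in₂ sing e)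
  extend (inj₂ sing) third  e = inj₁ (extend-in₃ sing e)

  extend-BothOrThird : SingletonNbr G u v → ExtendsBothOrThird G′ v ρ → ExtendsBoth G u ρ
  extend-BothOrThird (inj₁ sing) (inj₁ (e , _)) = extend-out₁ sing e
  extend-BothOrThird (inj₁ sing) (inj₂ e)       = extend-out₃ sing e
  extend-BothOrThird (inj₂ sing) (inj₁ (_ , e)) = extend-in₂ sing e
  extend-BothOrThird (inj₂ sing) (inj₂ e)       = extend-in₃ sing e

HasExactlyTwo-other : ∀ {R : Fin n → Set} → HasExactlyTwo R →
                      R p → R q → p ≢ q → R x → x ≢ p → x ≡ q
HasExactlyTwo-other (_ , _ , _ , _ , _ , only) rp rq p≢q rx x≢p
  with only _ rp | only _ rq | only _ rx
... | inj₁ refl | inj₁ refl | _         = ⊥-elim (p≢q refl)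
... | inj₂ refl | inj₂ refl | _         = ⊥-elim (p≢q refl)
... | _         | inj₁ refl | inj₁ refl = refl
... | _         | inj₂ refl | inj₂ refl = refl
... | inj₁ refl | _         | inj₁ refl = ⊥-elim (x≢p refl)
... | inj₂ refl | _         | inj₂ refl = ⊥-elim (x≢p refl)

Linked-tail : ∀ {R : ArcRel n} P → Linked R (u ∷ P) → Linked R P
Linked-tail []      _        = tt
Linked-tail (_ ∷ _) (_ , lk) = lk

Alternating-tail : ∀ {R : ArcRel n} P → Alternating R (u ∷ P) → Alternating R P
Alternating-tail []          _         = tt
Alternating-tail (_ ∷ [])    _         = tt
Alternating-tail (_ ∷ _ ∷ _) (_ , alt) = alt

All∉-∷ʳ : Unique (u ∷ P) → All (_∉ B) (u ∷ P) → All (_∉ B ∷ʳ u) P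
All∉-∷ʳ (u≢P ∷ _) (_ ∷ P∉B) =
  All.zipWith (λ (w∉B , u≢w) → ∉-∷ʳ w∉B (u≢w ∘ sym)) (P∉B , u≢P)

module _ {n} {AH : ArcRel n} (D : Subdigraph AH) where

  AntiDirectedPath-tail : AntiDirectedPath D (u ∷ P) → AntiDirectedPath D P
  AntiDirectedPath-tail {P = P} (_ ∷ vs , _ ∷ uniq , lk , alt) =
    vs , uniq , Linked-tail P lk , Alternating-tail P alt

  A-deleteVs-[] : A D x y → A (deleteVs D []) x y
  A-deleteVs-[] {x} {y} a = a , (A-src D x y a , λ ()) , (A-tgt D x y a , λ ())

  SingletonNbr-deleteVs-[] : SingletonNbr D u v → SingletonNbr (deleteVs D []) u v
  SingletonNbr-deleteVs-[] (inj₁ out) =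
    inj₁ λ w → proj₁ (out w) ∘ proj₁ , A-deleteVs-[] ∘ proj₂ (out w)
  SingletonNbr-deleteVs-[] (inj₂ inn) =
    inj₂ λ w → proj₁ (inn w) ∘ proj₁ , A-deleteVs-[] ∘ proj₂ (inn w)

  IsOrdering-deleteVs-[] : IsOrdering (deleteVs D []) σ → IsOrdering D σ
  IsOrdering-deleteVs-[] (uniq , mem) =
    uniq , λ w → proj₁ ∘ proj₁ (mem w) , λ vw → proj₂ (mem w) (vw , λ ())

  Extends-deleteVs-[] : ∀ {i} → Extends (deleteVs D []) v ρ i → Extends D v ρ i
  Extends-deleteVs-[] (σ₁ , σ₂ , σ₃ , ((o₁ , o₂ , o₃ , good) , v-first , v-last) , ρ⊆) =
    σ₁ , σ₂ , σ₃ ,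
    ((IsOrdering-deleteVs-[] o₁ , IsOrdering-deleteVs-[] o₂ , IsOrdering-deleteVs-[] o₃ ,
      λ x y → good x y ∘ A-deleteVs-[]) , v-first , v-last) ,
    ρ⊆

  deleteVs-∷ʳ : V D u → u ∉ B → IsVertexDeletion (deleteVs D B) u (deleteVs D (B ∷ʳ u))
  deleteVs-∷ʳ {u = u} {B = B} vu u∉B = record
    { V-deleted   = vu , u∉B
    ; V-remaining = λ w → mk⇔
        (λ (vw , w∉) → (vw , w∉ ∘ ∈-++⁺ˡ) , λ { refl → w∉ (∈-++⁺ʳ B (here refl)) })
        (λ ((vw , w∉B) , w≢u) → vw , ∉-∷ʳ w∉B w≢u)
    ; A-remaining = λ (a , (vx , x∉B) , (vy , y∉B)) x≢u y≢u →
                      a , (vx , ∉-∷ʳ x∉B x≢u) , (vy , ∉-∷ʳ y∉B y≢u)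
    }

  deleteVs-head : AntiDirectedPath D (u ∷ P) → All (_∉ B) (u ∷ P) →
                  IsVertexDeletion (deleteVs D B) u (deleteVs D (B ∷ʳ u))
  deleteVs-head (vu ∷ _ , _) (u∉B ∷ _) = deleteVs-∷ʳ vu u∉B

  module _ (reg : TwoRegular AH) where

    InNbrIsSingleton-deleteVs : u ∈ S → v ∉ S → w ∉ S → u ≢ w → V D v → V D w →
                                A D u v → A D w v → InNbrIsSingleton (deleteVs D S) v w
    InNbrIsSingleton-deleteVs {u} {S} {v} {w} u∈S v∉S w∉S u≢w vv vw auv awv x =
      only , λ { refl → awv , (vw , w∉S) , (vv , v∉S) }
      where
      only : A (deleteVs D S) x v → x ≡ w
      only (axv , (_ , x∉S) , _) =
        HasExactlyTwo-other (proj₂ (reg v)) (A⊆AH D u v auv) (A⊆AH D w v awv) u≢w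
                            (A⊆AH D x v axv) λ { refl → x∉S u∈S }

    OutNbrIsSingleton-deleteVs : u ∈ S → v ∉ S → w ∉ S → u ≢ w → V D v → V D w →
                                 A D v u → A D v w → OutNbrIsSingleton (deleteVs D S) v w
    OutNbrIsSingleton-deleteVs {u} {S} {v} {w} u∈S v∉S w∉S u≢w vv vw avu avw x =
      only , λ { refl → avw , (vv , v∉S) , (vw , w∉S) }
      where
      only : A (deleteVs D S) v x → x ≡ w
      only (avx , _ , (_ , x∉S)) =
        HasExactlyTwo-other (proj₁ (reg v)) (A⊆AH D v u avu) (A⊆AH D v w avw) u≢w
                            (A⊆AH D v x avx) λ { refl → x∉S u∈S }

    next-SingletonNbr : AntiDirectedPath D (u ∷ v ∷ w ∷ P) → All (_∉ B) (u ∷ v ∷ w ∷ P) →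
                        SingletonNbr (deleteVs D (B ∷ʳ u)) v w
    next-SingletonNbr {u = u} {v = v} {w = w} {B = B}
      (_ ∷ vv ∷ vw ∷ _ , (u≢v ∷ u≢w ∷ _) ∷ _ , (uv , _) , ((same-in , same-out) , _))
      (_ ∷ v∉B ∷ w∉B ∷ _) =
      [ (λ auv → inj₂ (InNbrIsSingleton-deleteVs u∈ v∉ w∉ u≢w vv vw auv (same-in auv))) ,
        (λ avu → inj₁ (OutNbrIsSingleton-deleteVs u∈ v∉ w∉ u≢w vv vw avu (same-out avu))) ]′ uv
      where
      u∈ : u ∈ B ∷ʳ u
      u∈ = ∈-++⁺ʳ B (here refl)
      v∉ : v ∉ B ∷ʳ u
      v∉ = ∉-∷ʳ v∉B (u≢v ∘ sym)
      w∉ : w ∉ B ∷ʳ u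
      w∉ = ∉-∷ʳ w∉B (u≢w ∘ sym)

    module _ (ori : Oriented AH) {xℓ : Fin n} {ρ : List (Fin n)} where
      open Insertion ori using (extend; extend-BothOrThird)

      reassociate : ∀ {i} B → Extends (deleteVs D (B ++ u ∷ S)) xℓ ρ i →
                    Extends (deleteVs D ((B ∷ʳ u) ++ S)) xℓ ρ i
      reassociate {u = u} {S = S} {i = i} B =
        subst (λ C → Extends (deleteVs D C) xℓ ρ i) (sym (++-assoc B (u ∷ []) S))

      extend-along-path : ∀ B u v zs →
             AntiDirectedPath D (u ∷ v ∷ zs ++ xℓ ∷ []) → All (_∉ B) (u ∷ v ∷ zs ++ xℓ ∷ []) →
             SingletonNbr (deleteVs D B) u v →
             Σ Slot (Extends (deleteVs D (B ++ u ∷ v ∷ zs)) xℓ ρ) →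
             ExtendsBoth (deleteVs D B) u ρ
      extend-along-path B u v [] path@(_ , uniq , _) disj sing (i , e) =
        extend-BothOrThird (deleteVs-head path disj) sing
          (extend (deleteVs-head (AntiDirectedPath-tail path) (All∉-∷ʳ uniq disj))
                  (next-SingletonNbr path disj) i (reassociate B e))
      extend-along-path B u v (w ∷ zs) path@(_ , uniq , _) disj sing (i , e) =
        extend-BothOrThird (deleteVs-head path disj) sing
          (inj₁ (extend-along-path (B ∷ʳ u) v w zs (AntiDirectedPath-tail path)
                   (All∉-∷ʳ uniq disj) (next-SingletonNbr path disj) (i , reassociate B e)))

lemma3 : ∀ {n : ℕ} (AH : ArcRel n) → Oriented AH → TwoRegular AH → Connected AH →
    (D : Subdigraph AH) →
    (x₁ x₂ : Fin n) (ys : List (Fin n)) (xℓ : Fin n) →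
    AntiDirectedPath D (x₁ ∷ x₂ ∷ ys ++ (xℓ ∷ [])) →
    (OutNbrIsSingleton D x₁ x₂ ⊎ InNbrIsSingleton D x₁ x₂) →
    (π¹ π₁ π : List (Fin n)) →
    VTriple (deleteVs D (x₁ ∷ x₂ ∷ ys)) xℓ π¹ π₁ π →
    (π* : List (Fin n)) → (π* ≡ π¹ ⊎ π* ≡ π₁) →
    (Σ (List (Fin n)) λ σ¹ → Σ (List (Fin n)) λ σ₁ → Σ (List (Fin n)) λ σ →
       VTriple D x₁ σ¹ σ₁ σ × π* ⊆ σ¹)
    ×
    (Σ (List (Fin n)) λ σ¹ → Σ (List (Fin n)) λ σ₁ → Σ (List (Fin n)) λ σ →
       VTriple D x₁ σ¹ σ₁ σ × π* ⊆ σ₁)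
lemma3 AH ori reg _ D x₁ x₂ ys xℓ path sing π¹ π₁ π vt π* π*-choice =
  Extends-deleteVs-[] D (proj₁ both) , Extends-deleteVs-[] D (proj₂ both)
  where
  start : Σ Slot (Extends (deleteVs D (x₁ ∷ x₂ ∷ ys)) xℓ π*)
  start = [ (λ π*≡π¹ → first  , π¹ , π₁ , π , vt , subst (_⊆ π¹) (sym π*≡π¹) ⊆-refl) ,
            (λ π*≡π₁ → second , π¹ , π₁ , π , vt , subst (_⊆ π₁) (sym π*≡π₁) ⊆-refl) ]′ π*-choice
  both : ExtendsBoth (deleteVs D []) x₁ π*
  both = extend-along-path D reg ori [] x₁ x₂ ys path (All.tabulate λ _ ())
                           (SingletonNbr-deleteVs-[] D sing) start
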